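{- For all integers $n\ge 2$ and $m\ge 1$, the umbrella graph with parameters $n,m$ is a difference graph.
   Context: A graph $G=(V,E)$ is a difference graph if there is a bijection $f$ from $V$ onto a set $S$ of positive integers such that for all distinct $x,y\in V$: $xy\in E$ if and only if $|f(x)-f(y)|\in S$. The umbrella graph with parameters $n,m$ has vertices $u_0,u_1,\dots,u_n,v_0,v_1,\dots,v_m$ and edges: $u_0u_i$ for $1\le i\le n$; $u_{i}u_{i+1}$ for $1\le i\le n-1$; $u_0v_0$; and $v_{j-1}v_j$ for $1\le j\le m$. (That is, a fan with apex $u_0$ over the path $u_1u_2\cdots u_n$, together with a path $u_0v_0v_1\cdots v_m$ attached at the apex.) -}

module Defs where

open import Data.Nat using (ℕ; zero; suc; _<_; ∣_-_∣; _≤_)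
open import Data.Fin using (Fin; toℕ)
open import Data.Sum using (_⊎_; inj₁; inj₂)
open import Data.Product using (Σ; ∃; _×_; _,_)
open import Relation.Binary.PropositionalEquality using (_≡_)
open import Relation.Nullary using (¬_)
open import Function.Definitions using (Injective)
open import Function.Bundles using (_⇔_)

record Graph (V : Set) : Set₁ where
  field
    Adj : V → V → Set

-- G is a difference graph: there is a bijection f from V onto a set S of
-- positive integers (S is the image of f, so f is an injection into the
-- positive integers with S = f[V]) such that for distinct x y,
-- x ~ y  iff  |f x - f y| ∈ S.
IsDifferenceGraph : {V : Set} → Graph V → Set
IsDifferenceGraph {V} G =
  Σ (V → ℕ) λ f →
    Injective _≡_ _≡_ f
    × (∀ x → 0 < f x)
    × (∀ x y → ¬ (x ≡ y) →
         (Graph.Adj G x y ⇔ (∃ λ z → f z ≡ ∣ f x - f y ∣)))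

-- Vertices of the umbrella graph: u i for i ∈ {0..n}, v j for j ∈ {0..m}.
UVertex : ℕ → ℕ → Set
UVertex n m = Fin (suc n) ⊎ Fin (suc m)

data UEdge (n m : ℕ) : UVertex n m → UVertex n m → Set where
  apex   : (i : Fin (suc n)) → 1 ≤ toℕ i →
           UEdge n m (inj₁ Data.Fin.zero) (inj₁ i)
  rim    : (i j : Fin (suc n)) → 1 ≤ toℕ i → toℕ j ≡ suc (toℕ i) →
           UEdge n m (inj₁ i) (inj₁ j)
  handle : UEdge n m (inj₁ Data.Fin.zero) (inj₂ Data.Fin.zero)
  stick  : (i j : Fin (suc m)) → toℕ j ≡ suc (toℕ i) →
           UEdge n m (inj₂ i) (inj₂ j)

umbrella : (n m : ℕ) → Graph (UVertex n m)
umbrella n m = record { Adj = λ x y → UEdge n m x y ⊎ UEdge n m y x }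

{-# OPTIONS --safe #-}
-- Label the apex u₀ by 2, the rim vertex u_i by 2i − 1, v₀ by c + 2 and v_j (j ≥ 1) by 2^(j−1) c,
-- where c = 4n.  Every edge is witnessed directly: consecutive rim labels differ by 2, the apex
-- and u_i differ by the label of u_(i−1), u₀ v₀ differ by c, and the path labels double.
-- Conversely, if label x = label y + label z then x and y are adjacent: parity (only rim labels are
-- odd), size and residues mod c (fan labels are below 2n, so two of them sum to less than c; path
-- labels are ≡ 2 or 0) rule out every other configuration.
module Submission where

open import Defs
open import Data.Nat using (ℕ; zero; suc; _+_; _*_; _^_; _<_; _≤_; s≤s; z≤n; ∣_-_∣; NonZero; >-nonZero; parity)
open import Data.Nat.Properties
open import Data.Nat.DivMod using (_%_; %-distribˡ-+; m<n⇒m%n≡m; m*n%n≡0; [m+n]%n≡m%n)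
open import Data.Parity.Base as ℙ using (Parity; 0ℙ; 1ℙ)
open import Data.Parity.Properties as ℙ using (+-homo-+; *-homo-*)
open import Data.Fin using (Fin; zero; suc; toℕ; inject₁)
open import Data.Fin.Properties using (toℕ-injective; toℕ<n; toℕ-inject₁)
open import Data.Sum using (_⊎_; inj₁; inj₂; swap)
open import Data.Product using (∃; _,_)
open import Function.Bundles using (_⇔_; mk⇔; Equivalence)
open import Function.Definitions using (Injective)
open import Relation.Binary.PropositionalEquality
open import Relation.Nullary using (contradiction)
open import Data.Nat.Tactic.RingSolver using (solve-∀)

∣m-n∣≡o⇔m≡n+o⊎n≡m+o : ∀ m n o → ∣ m - n ∣ ≡ o ⇔ (m ≡ n + o ⊎ n ≡ m + o)
∣m-n∣≡o⇔m≡n+o⊎n≡m+o m n o = mk⇔ to from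
  where
  to : ∣ m - n ∣ ≡ o → m ≡ n + o ⊎ n ≡ m + o
  to refl with ≤-total m n
  ... | inj₁ m≤n = inj₂ (sym (trans (cong (m +_) (m≤n⇒∣m-n∣≡n∸m m≤n)) (m+[n∸m]≡n m≤n)))
  ... | inj₂ n≤m = inj₁ (sym (trans (cong (n +_) (m≤n⇒∣n-m∣≡n∸m n≤m)) (m+[n∸m]≡n n≤m)))
  from : m ≡ n + o ⊎ n ≡ m + o → ∣ m - n ∣ ≡ o
  from (inj₁ refl) = trans (∣-∣-comm (n + o) n) (∣m-m+n∣≡n n o)
  from (inj₂ refl) = ∣m-m+n∣≡n m o

parity-2* : ∀ k → parity (2 * k) ≡ 0ℙ
parity-2* k = *-homo-* 2 k

1+2[1+a]≡1+2a+2 : ∀ a → 1 + 2 * suc a ≡ (1 + 2 * a) + 2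
1+2[1+a]≡1+2a+2 = solve-∀

2^-injective : ∀ i j → 2 ^ i ≡ 2 ^ j → i ≡ j
2^-injective zero    zero    _ = refl
2^-injective zero    (suc j) e = contradiction (sym e) (even≢odd (2 ^ j) 0)
2^-injective (suc i) zero    e = contradiction e (even≢odd (2 ^ i) 0)
2^-injective (suc i) (suc j) e = cong suc (2^-injective i j (*-cancelˡ-≡ (2 ^ i) (2 ^ j) 2 e))

2^i≡2^j+2^k⇒i≡1+j : ∀ i j k → 2 ^ i ≡ 2 ^ j + 2 ^ k → i ≡ suc j
2^i≡2^j+2^k⇒i≡1+j zero j k e =
  contradiction (subst (2 ≤_) (sym e) (+-mono-≤ (m^n>0 2 j) (m^n>0 2 k))) (<⇒≱ (s≤s (s≤s z≤n)))
2^i≡2^j+2^k⇒i≡1+j (suc i) zero    zero    e = cong suc (2^-injective i 0 (*-cancelˡ-≡ (2 ^ i) 1 2 e))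
2^i≡2^j+2^k⇒i≡1+j (suc i) zero    (suc k) e = contradiction e (even≢odd (2 ^ i) (2 ^ k))
2^i≡2^j+2^k⇒i≡1+j (suc i) (suc j) zero    e =
  contradiction (trans e (+-comm (2 ^ suc j) 1)) (even≢odd (2 ^ i) (2 ^ j))
2^i≡2^j+2^k⇒i≡1+j (suc i) (suc j) (suc k) e =
  cong suc (2^i≡2^j+2^k⇒i≡1+j i j k (*-cancelˡ-≡ (2 ^ i) (2 ^ j + 2 ^ k) 2
    (trans e (sym (*-distribˡ-+ 2 (2 ^ j) (2 ^ k))))))

-- Fin indices are shifted by one: u t is the rim vertex u_{t+1} and v j is the path vertex v_{j+1}.
pattern u₀  = inj₁ zero
pattern u t = inj₁ (suc t)
pattern v₀  = inj₂ zero
pattern v j = inj₂ (suc j)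

module UmbrellaLabelling (n m : ℕ) (2≤n : 2 ≤ n) where

  Vertex : Set
  Vertex = UVertex n (suc m)

  Adj : Vertex → Vertex → Set
  Adj = Graph.Adj (umbrella n (suc m))

  c : ℕ
  c = 4 * n

  label : Vertex → ℕ
  label u₀    = 2
  label (u t) = 1 + 2 * toℕ t
  label v₀    = c + 2
  label (v j) = 2 ^ toℕ j * c

  4<c : 4 < c
  4<c = <-≤-trans (s≤s (s≤s (s≤s (s≤s (s≤s z≤n))))) (*-monoʳ-≤ 4 2≤n)

  2<c : 2 < c
  2<c = <-trans (s≤s (s≤s (s≤s z≤n))) 4<c

  instance
    c-nonZero : NonZero c
    c-nonZero = >-nonZero (<-trans (s≤s z≤n) 2<c)

  fan-label<2n : ∀ i → label (inj₁ i) < 2 * n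
  fan-label<2n zero    = <-≤-trans (s≤s (s≤s (s≤s z≤n))) (*-monoʳ-≤ 2 2≤n)
  fan-label<2n (suc t) = subst (_≤ 2 * n) (*-suc 2 (toℕ t)) (*-monoʳ-≤ 2 (toℕ<n t))

  fan-label<c : ∀ i → label (inj₁ i) < c
  fan-label<c i = <-≤-trans (fan-label<2n i) (*-monoˡ-≤ n (m≤m+n 2 2))

  fan-label-sum<c : ∀ i j → label (inj₁ i) + label (inj₁ j) < c
  fan-label-sum<c i j = subst (label (inj₁ i) + label (inj₁ j) <_) (sym (*-distribʳ-+ n 2 2))
    (+-mono-< (fan-label<2n i) (fan-label<2n j))

  c≤path-label : ∀ j → c ≤ label (inj₂ j)
  c≤path-label zero    = m≤m+n c 2
  c≤path-label (suc j) = m≤n*m c (2 ^ toℕ j) {{m^n≢0 2 (toℕ j)}}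

  fan<path : ∀ i j → label (inj₁ i) < label (inj₂ j)
  fan<path i j = <-≤-trans (fan-label<c i) (c≤path-label j)

  path-label≢fan+fan : ∀ j i k → label (inj₂ j) ≢ label (inj₁ i) + label (inj₁ k)
  path-label≢fan+fan j i k eq = <⇒≱ (fan-label-sum<c i k) (subst (c ≤_) eq (c≤path-label j))

  c+2<label-v[1+j] : ∀ j → c + 2 < label (v (suc j))
  c+2<label-v[1+j] j = begin-strict
    c + 2                 <⟨ +-monoʳ-< c 2<c ⟩
    c + c                 ≡⟨ cong (c +_) (sym (+-identityʳ c)) ⟩
    2 * c                 ≤⟨ *-monoˡ-≤ c (*-monoʳ-≤ 2 (m^n>0 2 (toℕ j))) ⟩
    2 ^ suc (toℕ j) * c   ∎
    where open ≤-Reasoning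

  label-pos : ∀ x → 0 < label x
  label-pos u₀       = s≤s z≤n
  label-pos (u t)    = s≤s z≤n
  label-pos (inj₂ j) = <-≤-trans (<-trans (s≤s z≤n) 2<c) (c≤path-label j)

  labelParity : Vertex → Parity
  labelParity u₀       = 0ℙ
  labelParity (u _)    = 1ℙ
  labelParity (inj₂ _) = 0ℙ

  parity-c : parity c ≡ 0ℙ
  parity-c = *-homo-* 4 n

  parity-label : ∀ x → parity (label x) ≡ labelParity x
  parity-label u₀    = refl
  parity-label (u t) = trans (+-homo-+ 1 (2 * toℕ t)) (cong (1ℙ ℙ.+_) (parity-2* (toℕ t)))
  parity-label v₀    = trans (+-homo-+ c 2) (cong (ℙ._+ 0ℙ) parity-c)
  parity-label (v j) = trans (*-homo-* (2 ^ toℕ j) c) (trans (cong (parity (2 ^ toℕ j) ℙ.*_) parity-c) (ℙ.*-zeroʳ _))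

  parity-sum : ∀ {x y z} → label x ≡ label y + label z →
               labelParity x ≡ labelParity y ℙ.+ labelParity z
  parity-sum {x} {y} {z} eq = begin
    labelParity x                       ≡⟨ sym (parity-label x) ⟩
    parity (label x)                    ≡⟨ cong parity eq ⟩
    parity (label y + label z)          ≡⟨ +-homo-+ (label y) (label z) ⟩
    parity (label y) ℙ.+ parity (label z) ≡⟨ cong₂ ℙ._+_ (parity-label y) (parity-label z) ⟩
    labelParity y ℙ.+ labelParity z     ∎
    where open ≡-Reasoning

  parity-cong : ∀ {x y} → label x ≡ label y → labelParity x ≡ labelParity y
  parity-cong {x} {y} eq = trans (sym (parity-label x)) (trans (cong parity eq) (parity-label y))

  residue : Vertex → ℕ
  residue (inj₁ i) = label (inj₁ i)
  residue v₀       = 2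
  residue (v _)    = 0

  residue-label : ∀ x → label x % c ≡ residue x
  residue-label (inj₁ i) = m<n⇒m%n≡m (fan-label<c i)
  residue-label v₀       = trans (cong (_% c) (+-comm c 2)) (trans ([m+n]%n≡m%n 2 c) (m<n⇒m%n≡m 2<c))
  residue-label (v j)    = m*n%n≡0 (2 ^ toℕ j) c

  residue-sum : ∀ {x y z} → label x ≡ label y + label z → residue x ≡ (residue y + residue z) % c
  residue-sum {x} {y} {z} eq = begin
    residue x                          ≡⟨ sym (residue-label x) ⟩
    label x % c                        ≡⟨ cong (_% c) eq ⟩
    (label y + label z) % c            ≡⟨ %-distribˡ-+ (label y) (label z) c ⟩
    (label y % c + label z % c) % c    ≡⟨ cong₂ (λ a b → (a + b) % c) (residue-label y) (residue-label z) ⟩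
    (residue y + residue z) % c        ∎
    where open ≡-Reasoning

  residue-cong : ∀ {x y} → label x ≡ label y → residue x ≡ residue y
  residue-cong {x} {y} eq = trans (sym (residue-label x)) (trans (cong (_% c) eq) (residue-label y))

  0≢2%c : 0 ≢ 2 % c
  0≢2%c e = contradiction (trans e (m<n⇒m%n≡m 2<c)) λ ()

  0≢4%c : 0 ≢ 4 % c
  0≢4%c e = contradiction (trans e (m<n⇒m%n≡m 4<c)) λ ()

  record LabelSum (x y z : Vertex) : Set where
    constructor labelSum
    field
      labels   : label x ≡ label y + label z
      parities : labelParity x ≡ labelParity y ℙ.+ labelParity z
      residues : residue x ≡ (residue y + residue z) % c

  open LabelSum

  labelSum-of : ∀ x y z → label x ≡ label y + label z → LabelSum x y z
  labelSum-of x y z eq = labelSum eq (parity-sum {x} {y} {z} eq) (residue-sum {x} {y} {z} eq)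

  summand<sum : ∀ {x y z} → LabelSum x y z → label y < label x
  summand<sum {x} {y} {z} s = subst (label y <_) (sym (labels s)) (m<m+n (label y) (label-pos z))

  summand′<sum : ∀ {x y z} → LabelSum x y z → label z < label x
  summand′<sum {x} {y} {z} s =
    subst (label z <_) (trans (+-comm (label z) (label y)) (sym (labels s))) (m<m+n (label z) (label-pos y))

  apex-adjacent : ∀ y z → LabelSum u₀ y z → Adj u₀ y
  apex-adjacent u₀    _ s = contradiction (summand<sum s) (<-irrefl refl)
  apex-adjacent (u t) _ _ = inj₁ (apex (suc t) (s≤s z≤n))
  apex-adjacent v₀    _ _ = inj₁ handle
  apex-adjacent (v j) _ s = contradiction (summand<sum s) (<-asym (fan<path zero (suc j)))

  rim-adjacent : ∀ t y z → LabelSum (u t) y z → Adj (u t) y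
  rim-adjacent t u₀       _        _ = inj₂ (apex (suc t) (s≤s z≤n))
  rim-adjacent t (u l)    u₀       s = inj₂ (rim (suc l) (suc t) (s≤s z≤n) (cong suc t≡1+l))
    where
    t≡1+l : toℕ t ≡ suc (toℕ l)
    t≡1+l = *-cancelˡ-≡ (toℕ t) (suc (toℕ l)) 2
              (suc-injective (trans (labels s) (sym (1+2[1+a]≡1+2a+2 (toℕ l)))))
  rim-adjacent t (u _)    (u _)    (labelSum _ () _)
  rim-adjacent t (u _)    (inj₂ j) s = contradiction (summand′<sum s) (<-asym (fan<path (suc t) j))
  rim-adjacent t (inj₂ j) _        s = contradiction (summand<sum s) (<-asym (fan<path (suc t) j))

  base-adjacent : ∀ y z → LabelSum v₀ y z → Adj v₀ y
  base-adjacent u₀          _        _ = inj₂ handle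
  base-adjacent (u _)       u₀       (labelSum _ () _)
  base-adjacent (u l)       (u p)    s = contradiction (labels s) (path-label≢fan+fan zero (suc l) (suc p))
  base-adjacent (u _)       (inj₂ _) (labelSum _ () _)
  base-adjacent v₀          _        s = contradiction (summand<sum s) (<-irrefl refl)
  base-adjacent (v zero)    _        _ = inj₁ (stick zero (suc zero) refl)
  base-adjacent (v (suc j)) _        s = contradiction (summand<sum s) (<-asym (c+2<label-v[1+j] j))

  path-adjacent : ∀ i y z → LabelSum (v i) y z → Adj (v i) y
  path-adjacent i u₀    u₀    s = contradiction (residues s) 0≢4%c
  path-adjacent i u₀    (u _) (labelSum _ () _)
  path-adjacent i u₀    v₀    s = contradiction (residues s) 0≢4%c
  path-adjacent i u₀    (v _) s = contradiction (residues s) 0≢2%c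
  path-adjacent i (u _) u₀    (labelSum _ () _)
  path-adjacent i (u l) (u p) s = contradiction (labels s) (path-label≢fan+fan (suc i) (suc l) (suc p))
  path-adjacent i (u _) (inj₂ _) (labelSum _ () _)
  path-adjacent i v₀    u₀    s = contradiction (residues s) 0≢4%c
  path-adjacent i v₀    (u _) (labelSum _ () _)
  path-adjacent i v₀    v₀    s = contradiction (residues s) 0≢4%c
  path-adjacent i v₀    (v _) s = contradiction (residues s) 0≢2%c
  path-adjacent i (v _) u₀    s = contradiction (residues s) 0≢2%c
  path-adjacent i (v _) (u _) (labelSum _ () _)
  path-adjacent i (v _) v₀    s = contradiction (residues s) 0≢2%c
  path-adjacent i (v j) (v l) s = inj₂ (stick (suc j) (suc i) (cong suc i≡1+j))
    where
    i≡1+j : toℕ i ≡ suc (toℕ j)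
    i≡1+j = 2^i≡2^j+2^k⇒i≡1+j (toℕ i) (toℕ j) (toℕ l)
              (*-cancelʳ-≡ (2 ^ toℕ i) (2 ^ toℕ j + 2 ^ toℕ l) c
                (trans (labels s) (sym (*-distribʳ-+ c (2 ^ toℕ j) (2 ^ toℕ l)))))

  sum⇒adjacent : ∀ x y z → LabelSum x y z → Adj x y
  sum⇒adjacent u₀    = apex-adjacent
  sum⇒adjacent (u t) = rim-adjacent t
  sum⇒adjacent v₀    = base-adjacent
  sum⇒adjacent (v i) = path-adjacent i

  LabelsDifferBy : Vertex → Vertex → Vertex → Set
  LabelsDifferBy x y z = label x ≡ label y + label z ⊎ label y ≡ label x + label z

  edge⇒labelsDiffer : ∀ {x y} → UEdge n (suc m) x y → ∃ λ z → LabelsDifferBy x y z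
  edge⇒labelsDiffer (apex zero ())
  edge⇒labelsDiffer (apex (suc zero) _)    = u zero , inj₁ refl
  edge⇒labelsDiffer (apex (suc (suc t)) _) = u (inject₁ t) , inj₂ (begin
    1 + 2 * suc (toℕ t)           ≡⟨ 1+2[1+a]≡1+2a+2 (toℕ t) ⟩
    (1 + 2 * toℕ t) + 2           ≡⟨ +-comm (1 + 2 * toℕ t) 2 ⟩
    2 + (1 + 2 * toℕ t)           ≡⟨ cong (λ a → 2 + (1 + 2 * a)) (sym (toℕ-inject₁ t)) ⟩
    2 + (1 + 2 * toℕ (inject₁ t)) ∎)
    where open ≡-Reasoning
  edge⇒labelsDiffer (rim zero _ () _)
  edge⇒labelsDiffer (rim (suc _) zero _ ())
  edge⇒labelsDiffer (rim (suc a) (suc b) _ b≡1+a) = u₀ , inj₂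
    (trans (cong (λ k → 1 + 2 * k) (suc-injective b≡1+a)) (1+2[1+a]≡1+2a+2 (toℕ a)))
  edge⇒labelsDiffer handle = v zero , inj₂ (trans (+-comm c 2) (cong (2 +_) (sym (*-identityˡ c))))
  edge⇒labelsDiffer (stick zero zero ())
  edge⇒labelsDiffer (stick zero (suc zero) _) = u₀ , inj₁ (cong (_+ 2) (sym (*-identityˡ c)))
  edge⇒labelsDiffer (stick zero (suc (suc _)) ())
  edge⇒labelsDiffer (stick (suc _) zero ())
  edge⇒labelsDiffer (stick (suc a) (suc b) b≡1+a) = v a , inj₂
    (trans (cong (λ k → 2 ^ k * c) (suc-injective b≡1+a)) (2*p*q≡p*q+p*q (2 ^ toℕ a) c))
    where
    2*p*q≡p*q+p*q : ∀ p q → 2 * p * q ≡ p * q + p * q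
    2*p*q≡p*q+p*q = solve-∀

  label-injective : Injective _≡_ _≡_ label
  label-injective {u₀}     {u₀}     _ = refl
  label-injective {u₀}     {u t}    e = contradiction (parity-cong {u₀} {u t} e) λ ()
  label-injective {u t}    {u₀}     e = contradiction (parity-cong {u t} {u₀} e) λ ()
  label-injective {u t}    {u l}    e =
    cong u (toℕ-injective (*-cancelˡ-≡ (toℕ t) (toℕ l) 2 (suc-injective e)))
  label-injective {inj₁ i} {inj₂ j} e = contradiction e (<⇒≢ (fan<path i j))
  label-injective {inj₂ j} {inj₁ i} e = contradiction (sym e) (<⇒≢ (fan<path i j))
  label-injective {v₀}     {v₀}     _ = refl
  label-injective {v₀}     {v j}    e = contradiction (residue-cong {v₀} {v j} e) λ ()
  label-injective {v j}    {v₀}     e = contradiction (residue-cong {v j} {v₀} e) λ ()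
  label-injective {v i}    {v j}    e =
    cong v (toℕ-injective (2^-injective (toℕ i) (toℕ j) (*-cancelʳ-≡ (2 ^ toℕ i) (2 ^ toℕ j) c e)))

  adjacent⇔difference-is-label : ∀ x y → Adj x y ⇔ (∃ λ z → label z ≡ ∣ label x - label y ∣)
  adjacent⇔difference-is-label x y = mk⇔ to from
    where
    difference⇔ : ∀ z → ∣ label x - label y ∣ ≡ label z ⇔ LabelsDifferBy x y z
    difference⇔ z = ∣m-n∣≡o⇔m≡n+o⊎n≡m+o (label x) (label y) (label z)

    to : Adj x y → ∃ λ z → label z ≡ ∣ label x - label y ∣
    to (inj₁ xy) = let z , d = edge⇒labelsDiffer xy in z , sym (Equivalence.from (difference⇔ z) d)
    to (inj₂ yx) = let z , d = edge⇒labelsDiffer yx in z , sym (Equivalence.from (difference⇔ z) (swap d))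

    from : (∃ λ z → label z ≡ ∣ label x - label y ∣) → Adj x y
    from (z , e) with Equivalence.to (difference⇔ z) (sym e)
    ... | inj₁ x=y+z = sum⇒adjacent x y z (labelSum-of x y z x=y+z)
    ... | inj₂ y=x+z = swap (sum⇒adjacent y x z (labelSum-of y x z y=x+z))

  isDifferenceGraph : IsDifferenceGraph (umbrella n (suc m))
  isDifferenceGraph = label , label-injective , label-pos , λ x y _ → adjacent⇔difference-is-label x y

theorem3p5 : (n m : ℕ) → 2 ≤ n → 1 ≤ m → IsDifferenceGraph (umbrella n m)
theorem3p5 n (suc m) 2≤n _ = UmbrellaLabelling.isDifferenceGraph n m 2≤n
theorem3p5 n zero _ ()
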